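{- Let $G$ be a directed acyclic multigraph with single source $s$ and single sink $t$. (1) If $G$ is width-stable, then $\mathrm{fwidth}(G,f)=\mathrm{width}(G|_f)$ for all non-negative integer flows $f$ on $G$. (2) $G$ is width-stable if and only if $\mathrm{fwidth}(G,f)\le \mathrm{fwidth}(G,h)$ for all non-negative integer flows $0\le f\le h$ on $G$.
   Context: A flow is $f:E(G)\to\mathbb{N}$ with conservation at vertices other than $s,t$; $f\le h$ means $f(e)\le h(e)$ for all edges. The flow-subgraph $G|_f$ has edge set $\{e:f(e)>0\}$ and vertex set $V(G)$ minus the vertices whose total incoming and total outgoing flow are both $0$. $\mathrm{width}(H)$ is the minimum number of source-to-sink paths covering all edges of $H$. $G$ is width-stable if $\mathrm{width}(G|_f)\le\mathrm{width}(G|_g)$ for all non-negative integer flows $0\le f\le g$. The flow-width $\mathrm{fwidth}(G,f)$ is the smallest number of $s$-$t$ paths such that every edge with $f(e)>0$ lies on at least one path and every edge $e$ lies on at most $f(e)$ paths. -}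

module Defs where

open import Data.Nat using (ℕ; zero; suc; _≤_; _<_)
open import Data.Fin using (Fin; _≟_)
open import Data.List using (List; []; _∷_; length; filter; map)
open import Data.Nat.ListAction using (sum)
open import Data.List.Relation.Unary.All using (All)
open import Data.List.Relation.Unary.Any using (Any; any?)
open import Data.List.Membership.Propositional using (_∈_)
open import Data.Product using (Σ; _×_; ∃; ∃-syntax)
open import Relation.Binary.PropositionalEquality using (_≡_)
open import Relation.Nullary using (¬_)
open import Data.List.Base using (allFin)

record Multigraph : Set where
  field
    n  : ℕ
    m  : ℕ
    tl : Fin m → Fin n
    hd : Fin m → Fin n

open Multigraph public

Vertex : Multigraph → Set
Vertex G = Fin (n G)

Edge : Multigraph → Set
Edge G = Fin (m G)

data Walk (G : Multigraph) : Vertex G → Vertex G → List (Edge G) → Set where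
  nil  : ∀ {u} → Walk G u u []
  cons : ∀ {u w e es} → tl G e ≡ u → Walk G (hd G e) w es → Walk G u w (e ∷ es)

Acyclic : Multigraph → Set
Acyclic G = ∀ (v : Vertex G) (e : Edge G) (es : List (Edge G)) → ¬ Walk G v v (e ∷ es)

IsSource : (G : Multigraph) → Vertex G → Set
IsSource G v = ∀ (e : Edge G) → ¬ (hd G e ≡ v)

IsSink : (G : Multigraph) → Vertex G → Set
IsSink G v = ∀ (e : Edge G) → ¬ (tl G e ≡ v)

SingleSource : (G : Multigraph) → Vertex G → Set
SingleSource G s = IsSource G s × (∀ v → IsSource G v → v ≡ s)

SingleSink : (G : Multigraph) → Vertex G → Set
SingleSink G t = IsSink G t × (∀ v → IsSink G v → v ≡ t)

inflow : (G : Multigraph) → (Edge G → ℕ) → Vertex G → ℕ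
inflow G f v = sum (map f (filter (λ e → hd G e ≟ v) (allFin (m G))))

outflow : (G : Multigraph) → (Edge G → ℕ) → Vertex G → ℕ
outflow G f v = sum (map f (filter (λ e → tl G e ≟ v) (allFin (m G))))

IsFlow : (G : Multigraph) → Vertex G → Vertex G → (Edge G → ℕ) → Set
IsFlow G s t f = ∀ v → ¬ (v ≡ s) → ¬ (v ≡ t) → inflow G f v ≡ outflow G f v

_≤ᶠ_ : {A : Set} → (A → ℕ) → (A → ℕ) → Set
f ≤ᶠ h = ∀ e → f e ≤ h e

IsMin : (ℕ → Set) → ℕ → Set
IsMin P k = P k × (∀ j → P j → k ≤ j)

InSupp : (G : Multigraph) → (Edge G → ℕ) → Edge G → Set
InSupp G f e = 0 < f e

InSubVertex : (G : Multigraph) → (Edge G → ℕ) → Vertex G → Set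
InSubVertex G f v = ¬ (inflow G f v ≡ 0 × outflow G f v ≡ 0)

SubSource : (G : Multigraph) → (Edge G → ℕ) → Vertex G → Set
SubSource G f v = InSubVertex G f v × (∀ e → InSupp G f e → ¬ (hd G e ≡ v))

SubSink : (G : Multigraph) → (Edge G → ℕ) → Vertex G → Set
SubSink G f v = InSubVertex G f v × (∀ e → InSupp G f e → ¬ (tl G e ≡ v))

SubPath : (G : Multigraph) → (Edge G → ℕ) → List (Edge G) → Set
SubPath G f p = ∃[ u ] ∃[ w ] (Walk G u w p × SubSource G f u × SubSink G f w × All (InSupp G f) p)

WidthCover : (G : Multigraph) → (Edge G → ℕ) → ℕ → Set
WidthCover G f k = Σ (List (List (Edge G))) λ ps →
  length ps ≡ k × All (SubPath G f) ps × (∀ e → InSupp G f e → Any (e ∈_) ps)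

Width : (G : Multigraph) → (Edge G → ℕ) → ℕ → Set
Width G f k = IsMin (WidthCover G f) k

WidthStable : (G : Multigraph) → Vertex G → Vertex G → Set
WidthStable G s t = ∀ (f g : Edge G → ℕ) → IsFlow G s t f → IsFlow G s t g → f ≤ᶠ g →
  ∀ a b → Width G f a → Width G g b → a ≤ b

count : (G : Multigraph) → Edge G → List (List (Edge G)) → ℕ
count G e ps = length (filter (λ p → any? (e ≟_) p) ps)

FWidthCover : (G : Multigraph) → Vertex G → Vertex G → (Edge G → ℕ) → ℕ → Set
FWidthCover G s t f k = Σ (List (List (Edge G))) λ ps →
  length ps ≡ k × All (Walk G s t) ps × (∀ e → 0 < f e → Any (e ∈_) ps)
  × (∀ e → count G e ps ≤ f e)

FWidth : (G : Multigraph) → Vertex G → Vertex G → (Edge G → ℕ) → ℕ → Set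
FWidth G s t f k = IsMin (FWidthCover G s t f) k

{-# OPTIONS --safe #-}
-- Dropping the empty paths of an fwidth cover of f leaves a width cover of G|f, so
-- fwidth f ≥ width (G|f). Conversely a width cover of size a is an fwidth cover of k·f once
-- k ≥ a, so fwidth (k·f) = width (G|f); this turns monotonicity of fwidth into width stability.
--
-- Under width stability, fwidth f ≤ width (G|f) is proved by induction on the total flow. If an
-- s-t path P carries flow ≥ 2 on every edge, f − P has the same flow-subgraph and its fwidth
-- covers are fwidth covers of f. Otherwise the set R of vertices reachable from s along edges of
-- flow ≥ 2 separates s from t, and the edges leaving R carry flow ≤ 1. Decompose f into s-t paths
-- R₁ … R_r and replace each Rᵢ by a path of flow-≥-2 edges from s to the tail of the last edge
-- on which Rᵢ leaves R, followed by the rest of Rᵢ. These pieces leave R once and never return, so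
-- every path of the flow-subgraph of their sum f₁ leaves R at most once, while f₁ puts r units on
-- edges of flow ≤ 1 leaving R. Hence fwidth f ≤ r ≤ width (G|f₁) ≤ width (G|(f₁ + f)) = width (G|f),
-- the first step because the decomposition is an fwidth cover of f, the third by width stability.
module Submission where

open import Defs
open import Data.Nat using (ℕ; _≤_)
open import Data.Product using (Σ; _×_)
open import Function.Bundles using (_⇔_)

open import Data.Empty using (⊥-elim)
open import Data.Fin using (Fin; _≟_; zero; suc)
open import Data.Fin.Properties using (any?; all?; injective⇒≤)
open import Data.List using (List; []; _∷_; _++_; length; filter; map; allFin; lookup; reverse)
open import Data.List.Membership.Propositional using (_∈_; find; lose)
open import Data.List.Membership.Propositional.Properties
  using (∈-filter⁺; ∈-filter⁻; ∈-allFin; ∈-++⁺ʳ; ∈-lookup)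
open import Data.List.Properties
  using (length-map; length-++; length-reverse; length-filter; map-++; unfold-reverse;
         filter-++; filter-accept; filter-reject; filter-some; filter-none)
open import Data.List.Relation.Unary.All using (All; []; _∷_)
import Data.List.Relation.Unary.All as All
open import Data.List.Relation.Unary.All.Properties using (++⁺)
open import Data.List.Relation.Unary.Any using (Any; here; there)
import Data.List.Relation.Unary.Any as Any
open import Data.List.Relation.Unary.Any.Properties using (reverse⁻)
open import Data.List.Relation.Unary.Unique.Propositional using (Unique; []; _∷_)
open import Data.List.Relation.Unary.Unique.Propositional.Properties using (allFin⁺; map⁻)
open import Data.Nat using (zero; suc; z<s; _+_; _*_; _∸_; _<_; z≤n; s≤s; _<?_; _≤?_)
open import Data.Nat.ListAction using (sum)
open import Data.Nat.ListAction.Properties using (sum-++)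
open import Data.Nat.Properties hiding (_≟_)
open import Algebra.Properties.CommutativeSemigroup +-commutativeSemigroup using (interchange)
open import Data.Product using (_,_; ∃; proj₁; proj₂; swap)
open import Data.Sum using (_⊎_; inj₁; inj₂; [_,_])
open import Function.Bundles using (mk⇔)
open import Relation.Binary.PropositionalEquality
  using (_≡_; refl; sym; trans; cong; cong₂; subst; subst₂; module ≡-Reasoning)
open import Relation.Nullary using (¬_; Dec; yes; no)
open import Relation.Nullary.Decidable using (_×-dec_; _→-dec_; ¬?)
open import Relation.Unary using (Decidable; _⊆_; _≐_)

-- Sums and multiplicities

∑ : {A : Set} → List A → (A → ℕ) → ℕ
∑ xs f = sum (map f xs)

module _ {A : Set} where

  ∑-cong : ∀ xs {f g : A → ℕ} → (∀ x → f x ≡ g x) → ∑ xs f ≡ ∑ xs g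
  ∑-cong []       eq = refl
  ∑-cong (x ∷ xs) eq = cong₂ _+_ (eq x) (∑-cong xs eq)

  ∑-++ : ∀ xs ys (f : A → ℕ) → ∑ (xs ++ ys) f ≡ ∑ xs f + ∑ ys f
  ∑-++ xs ys f = trans (cong sum (map-++ f xs ys)) (sum-++ (map f xs) (map f ys))

  ∑-+ : ∀ xs (f g : A → ℕ) → ∑ xs (λ x → f x + g x) ≡ ∑ xs f + ∑ xs g
  ∑-+ []       f g = refl
  ∑-+ (x ∷ xs) f g =
    trans (cong (f x + g x +_) (∑-+ xs f g)) (interchange (f x) (g x) (∑ xs f) (∑ xs g))

  *-distribˡ-∑ : ∀ xs k (f : A → ℕ) → ∑ xs (λ x → k * f x) ≡ k * ∑ xs f
  *-distribˡ-∑ []       k f = sym (*-zeroʳ k)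
  *-distribˡ-∑ (x ∷ xs) k f =
    trans (cong (k * f x +_) (*-distribˡ-∑ xs k f)) (sym (*-distribˡ-+ k (f x) (∑ xs f)))

  ∑-const-1 : ∀ (xs : List A) → ∑ xs (λ _ → 1) ≡ length xs
  ∑-const-1 []       = refl
  ∑-const-1 (x ∷ xs) = cong suc (∑-const-1 xs)

  ∑-mono-≤ : ∀ xs {f g : A → ℕ} → (∀ {x} → x ∈ xs → f x ≤ g x) → ∑ xs f ≤ ∑ xs g
  ∑-mono-≤ []       le = z≤n
  ∑-mono-≤ (x ∷ xs) le = +-mono-≤ (le (here refl)) (∑-mono-≤ xs (λ y∈ → le (there y∈)))

  ∑-mono-< : ∀ xs {f g : A → ℕ} → (∀ {x} → x ∈ xs → f x ≤ g x) →
             ∀ {y} → y ∈ xs → f y < g y → ∑ xs f < ∑ xs g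
  ∑-mono-< (x ∷ xs) le (here refl) lt = +-mono-<-≤ lt (∑-mono-≤ xs (λ y∈ → le (there y∈)))
  ∑-mono-< (x ∷ xs) le (there y∈)  lt =
    +-mono-≤-< (le (here refl)) (∑-mono-< xs (λ z∈ → le (there z∈)) y∈ lt)

  term≤∑ : ∀ {xs x} (f : A → ℕ) → x ∈ xs → f x ≤ ∑ xs f
  term≤∑ {y ∷ xs} f (here refl) = m≤m+n (f y) (∑ xs f)
  term≤∑ {y ∷ xs} f (there x∈)  = ≤-trans (term≤∑ f x∈) (m≤n+m (∑ xs f) (f y))

  ∑-pos : ∀ xs (f : A → ℕ) → 0 < ∑ xs f → ∃ λ x → x ∈ xs × 0 < f x
  ∑-pos (x ∷ xs) f pos with f x in fx
  ... | suc _ = x , here refl , subst (0 <_) (sym fx) z<s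
  ... | zero with ∑-pos xs f pos
  ...   | y , y∈ , fy>0 = y , there y∈ , fy>0

  ∑-zero : ∀ xs {f : A → ℕ} → (∀ {x} → x ∈ xs → f x ≡ 0) → ∑ xs f ≡ 0
  ∑-zero []       z = refl
  ∑-zero (x ∷ xs) z = cong₂ _+_ (z (here refl)) (∑-zero xs (λ y∈ → z (there y∈)))

  ∑≡0-mono : ∀ xs {f g : A → ℕ} → (∀ {x} → 0 < f x → 0 < g x) → ∑ xs g ≡ 0 → ∑ xs f ≡ 0
  ∑≡0-mono xs {f} {g} f⊆g g≡0 = ∑-zero xs (λ {x} x∈ → n≤0⇒n≡0 (≮⇒≥ (λ fx>0 →
    <⇒≢ (f⊆g fx>0) (sym (n≤0⇒n≡0 (subst (g x ≤_) g≡0 (term≤∑ g x∈)))))))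

module _ {A B : Set} where

  ∑-swap : ∀ (xs : List A) (ys : List B) (h : B → A → ℕ) →
           ∑ xs (λ x → ∑ ys (λ y → h y x)) ≡ ∑ ys (λ y → ∑ xs (h y))
  ∑-swap xs []       h = ∑-zero xs (λ _ → refl)
  ∑-swap xs (y ∷ ys) h =
    trans (∑-+ xs (h y) (λ x → ∑ ys (λ y′ → h y′ x))) (cong (∑ xs (h y) +_) (∑-swap xs ys h))

+-pos⁻ : ∀ a {b} → 0 < a + b → 0 < a ⊎ 0 < b
+-pos⁻ zero    pos = inj₂ pos
+-pos⁻ (suc a) _   = inj₁ z<s

*-pos⁻ʳ : ∀ k {x} → 0 < k * x → 0 < x
*-pos⁻ʳ k {zero}  pos = ⊥-elim (<-irrefl refl (subst (0 <_) (*-zeroʳ k) pos))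
*-pos⁻ʳ k {suc x} pos = z<s

module _ {k : ℕ} where

  δ : Fin k → Fin k → ℕ
  δ a b with a ≟ b
  ... | yes _ = 1
  ... | no  _ = 0

  δ-refl : ∀ a → δ a a ≡ 1
  δ-refl a with a ≟ a
  ... | yes _  = refl
  ... | no a≢a = ⊥-elim (a≢a refl)

  δ-≢ : ∀ {a b} → ¬ a ≡ b → δ a b ≡ 0
  δ-≢ {a} {b} a≢b with a ≟ b
  ... | yes a≡b = ⊥-elim (a≢b a≡b)
  ... | no  _   = refl

  δ-pos : ∀ {a b} → 0 < δ a b → a ≡ b
  δ-pos {a} {b} pos with a ≟ b
  ... | yes a≡b = a≡b

  δ-sym : ∀ a b → δ a b ≡ δ b a
  δ-sym a b with a ≟ b
  ... | yes refl = sym (δ-refl a)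
  ... | no  a≢b  = sym (δ-≢ (λ b≡a → a≢b (sym b≡a)))

  occ : Fin k → List (Fin k) → ℕ
  occ e xs = ∑ xs (δ e)

  occ-pos : ∀ {e xs} → e ∈ xs → 0 < occ e xs
  occ-pos {e} e∈ = ≤-trans (≤-reflexive (sym (δ-refl e))) (term≤∑ (δ e) e∈)

  occ-pos⁻ : ∀ {e} xs → 0 < occ e xs → e ∈ xs
  occ-pos⁻ {e} xs pos with ∑-pos xs (δ e) pos
  ... | x , x∈ , δ>0 = subst (_∈ xs) (sym (δ-pos δ>0)) x∈

  occ-∉ : ∀ {e} xs → ¬ e ∈ xs → occ e xs ≡ 0
  occ-∉ xs e∉ = ∑-zero xs (λ x∈ → δ-≢ (λ { refl → e∉ x∈ }))

  occ-unique : ∀ {e xs} → Unique xs → e ∈ xs → occ e xs ≡ 1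
  occ-unique {e} {x ∷ xs} (x∉ ∷ _) (here refl) =
    cong₂ _+_ (δ-refl e) (occ-∉ xs (λ e∈ → All.lookup x∉ e∈ refl))
  occ-unique {e} {x ∷ xs} (x∉ ∷ u) (there e∈) =
    cong₂ _+_ (δ-≢ (λ { refl → All.lookup x∉ e∈ refl })) (occ-unique u e∈)

  occ-unique≤1 : ∀ {xs} → Unique xs → ∀ e → occ e xs ≤ 1
  occ-unique≤1 {xs} u e with Any.any? (e ≟_) xs
  ... | yes e∈ = ≤-reflexive (occ-unique u e∈)
  ... | no  e∉ = subst (_≤ 1) (sym (occ-∉ xs e∉)) z≤n

  module _ {P : Fin k → Set} (P? : Decidable P) where

    occ-filter : ∀ {x} → P x → ∀ ys → occ x (filter P? ys) ≡ occ x ys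
    occ-filter px []       = refl
    occ-filter {x} px (y ∷ ys) with P? y
    ... | yes _  = cong (δ x y +_) (occ-filter px ys)
    ... | no ¬py = trans (occ-filter px ys) (cong (_+ occ x ys) (sym (δ-≢ (λ { refl → ¬py px }))))

    occ-filter-¬ : ∀ {x} → ¬ P x → ∀ ys → occ x (filter P? ys) ≡ 0
    occ-filter-¬ ¬px ys = occ-∉ (filter P? ys) (λ x∈ → ¬px (proj₂ (∈-filter⁻ P? {xs = ys} x∈)))

    occ-filter-allFin : ∀ x → occ x (filter P? (allFin k)) ≡ length (filter P? (x ∷ []))
    occ-filter-allFin x with P? x
    ... | yes px  = trans (occ-filter px (allFin k)) (occ-unique (allFin⁺ k) (∈-allFin x))
    ... | no  ¬px = occ-filter-¬ ¬px (allFin k)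

    ∑-length-filter : ∀ xs → ∑ xs (λ x → length (filter P? (x ∷ []))) ≡ length (filter P? xs)
    ∑-length-filter []       = refl
    ∑-length-filter (x ∷ xs) = sym (begin
      length (filter P? (x ∷ xs))                         ≡⟨ cong length (filter-++ P? (x ∷ []) xs) ⟩
      length (filter P? (x ∷ []) ++ filter P? xs)         ≡⟨ length-++ (filter P? (x ∷ [])) ⟩
      length (filter P? (x ∷ [])) + length (filter P? xs) ≡⟨ cong (_ +_) (∑-length-filter xs) ⟨
      ∑ (x ∷ xs) (λ y → length (filter P? (y ∷ [])))      ∎)
      where open ≡-Reasoning

    ∑-occ-filter : ∀ xs → ∑ (filter P? (allFin k)) (λ e → occ e xs) ≡ length (filter P? xs)
    ∑-occ-filter xs = begin
      ∑ F (λ e → ∑ xs (δ e))                   ≡⟨ ∑-swap F xs (λ x e → δ e x) ⟩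
      ∑ xs (λ x → ∑ F (λ e → δ e x))           ≡⟨ ∑-cong xs (λ x → ∑-cong F (λ e → δ-sym e x)) ⟩
      ∑ xs (λ x → occ x F)                     ≡⟨ ∑-cong xs occ-filter-allFin ⟩
      ∑ xs (λ x → length (filter P? (x ∷ []))) ≡⟨ ∑-length-filter xs ⟩
      length (filter P? xs)                    ∎
      where
      open ≡-Reasoning
      F = filter P? (allFin k)

lookup-injective : {A : Set} {xs : List A} → Unique xs →
                   ∀ {i j} → lookup xs i ≡ lookup xs j → i ≡ j
lookup-injective {xs = x ∷ xs} (x∉ ∷ u) {zero}  {zero}  eq = refl
lookup-injective {xs = x ∷ xs} (x∉ ∷ u) {zero}  {suc j} eq =
  ⊥-elim (All.lookup x∉ (∈-lookup {xs = xs} j) eq)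
lookup-injective {xs = x ∷ xs} (x∉ ∷ u) {suc i} {zero}  eq =
  ⊥-elim (All.lookup x∉ (∈-lookup {xs = xs} i) (sym eq))
lookup-injective {xs = x ∷ xs} (x∉ ∷ u) {suc i} {suc j} eq = cong suc (lookup-injective u eq)

unique-length≤ : ∀ {k} {xs : List (Fin k)} → Unique xs → length xs ≤ k
unique-length≤ u = injective⇒≤ (lookup-injective u)

∈⇒length-pos : {A : Set} {x : A} {xs : List A} → x ∈ xs → 0 < length xs
∈⇒length-pos (here _)  = z<s
∈⇒length-pos (there _) = z<s

-- Walks

module _ (G : Multigraph) where

  walk-++ : ∀ {u v w xs ys} → Walk G u v xs → Walk G v w ys → Walk G u w (xs ++ ys)
  walk-++ nil         q = q
  walk-++ (cons eq p) q = cons eq (walk-++ p q)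

  walk-[] : ∀ {u w} → Walk G u w [] → u ≡ w
  walk-[] nil = refl

  walk-to-hd : ∀ {u w es v} → Walk G u w es → v ∈ map (hd G) es →
               ∃ λ e → ∃ λ ps → Walk G u v (e ∷ ps)
  walk-to-hd {es = e ∷ es} (cons eq p) (here refl) = e , [] , cons eq nil
  walk-to-hd {es = e ∷ es} (cons eq p) (there v∈) with walk-to-hd p v∈
  ... | e′ , ps , q = e , e′ ∷ ps , cons eq q

  walk-end-edge : ∀ {u w e es} → Walk G u w (e ∷ es) → ∃ λ x → x ∈ e ∷ es × hd G x ≡ w
  walk-end-edge (cons _ nil)           = _ , here refl , refl
  walk-end-edge (cons _ p@(cons _ _)) with walk-end-edge p
  ... | x , x∈ , hd≡w = x , there x∈ , hd≡w

  module _ (acyclic : Acyclic G) where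

    walk-vertices-unique : ∀ {u w es} → Walk G u w es → Unique (u ∷ map (hd G) es)
    walk-vertices-unique nil = [] ∷ []
    walk-vertices-unique {u} p@(cons _ q) = All.tabulate u-not-revisited ∷ walk-vertices-unique q
      where
      u-not-revisited : ∀ {v} → v ∈ map (hd G) _ → ¬ u ≡ v
      u-not-revisited v∈ refl with walk-to-hd p v∈
      ... | e , ps , cycle = acyclic u e ps cycle

    walk-edges-unique : ∀ {u w es} → Walk G u w es → Unique es
    walk-edges-unique p with walk-vertices-unique p
    ... | _ ∷ heads-unique = map⁻ heads-unique

    walk-length< : ∀ {u w es} → Walk G u w es → length es < n G
    walk-length< {es = es} p =
      subst (_≤ n G) (cong suc (length-map (hd G) es)) (unique-length≤ (walk-vertices-unique p))

    walk-occ≤1 : ∀ {u w es} → Walk G u w es → ∀ e → occ e es ≤ 1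
    walk-occ≤1 p = occ-unique≤1 (walk-edges-unique p)

    occ≤positive : ∀ {u w p} {g : Edge G → ℕ} → Walk G u w p → All (InSupp G g) p →
                   ∀ x → occ x p ≤ g x
    occ≤positive {p = p} {g} W pos x with Any.any? (x ≟_) p
    ... | yes x∈ = ≤-trans (walk-occ≤1 W x) (All.lookup pos x∈)
    ... | no  x∉ = subst (_≤ g x) (sym (occ-∉ p x∉)) z≤n

reversed : Multigraph → Multigraph
reversed G = record { n = n G ; m = m G ; tl = hd G ; hd = tl G }

module _ (G : Multigraph) where

  walk-reversed : ∀ {u w es} → Walk (reversed G) u w es → Walk G w u (reverse es)
  walk-reversed nil = nil
  walk-reversed (cons {e = e} {es} refl p) =
    subst (Walk G _ _) (sym (unfold-reverse e es)) (walk-++ G (walk-reversed p) (cons refl nil))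

  reversed-walk-length< : Acyclic G → ∀ {u w es} → Walk (reversed G) u w es → length es < n G
  reversed-walk-length< acyclic {es = es} p =
    subst (_< n G) (length-reverse es) (walk-length< G acyclic (walk-reversed p))

  all-reverse : ∀ {P : Edge G → Set} {es} → All P es → All P (reverse es)
  all-reverse ps = All.tabulate (λ x∈ → All.lookup ps (reverse⁻ x∈))

  flow-reversed : ∀ {s t f} → IsFlow G s t f → IsFlow (reversed G) t s f
  flow-reversed F v v≢t v≢s = sym (F v v≢s v≢t)

-- Flows and their path decompositions

module _ (G : Multigraph) where

  edgesInto edgesOutOf : Vertex G → List (Edge G)
  edgesInto  v = filter (λ e → hd G e ≟ v) (allFin (m G))
  edgesOutOf v = filter (λ e → tl G e ≟ v) (allFin (m G))

  flow≤inflow : ∀ f e → f e ≤ inflow G f (hd G e)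
  flow≤inflow f e = term≤∑ f (∈-filter⁺ (λ x → hd G x ≟ hd G e) (∈-allFin e) refl)

  flow≤outflow : ∀ f e → f e ≤ outflow G f (tl G e)
  flow≤outflow f e = term≤∑ f (∈-filter⁺ (λ x → tl G x ≟ tl G e) (∈-allFin e) refl)

  inflow≡0 : ∀ {f u} → (∀ e → InSupp G f e → ¬ hd G e ≡ u) → inflow G f u ≡ 0
  inflow≡0 {f} {u} no-in = ∑-zero (edgesInto u) (λ {e} e∈ → n≤0⇒n≡0 (≮⇒≥ (λ fe>0 →
    no-in e fe>0 (proj₂ (∈-filter⁻ (λ x → hd G x ≟ u) {xs = allFin (m G)} e∈)))))

  entering leaving : Vertex G → List (Edge G) → ℕ
  entering v es = length (filter (λ e → hd G e ≟ v) es)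
  leaving  v es = length (filter (λ e → tl G e ≟ v) es)

  length-filter-∷ : ∀ (end : Edge G → Vertex G) e es v →
    length (filter (λ x → end x ≟ v) (e ∷ es)) ≡ δ (end e) v + length (filter (λ x → end x ≟ v) es)
  length-filter-∷ end e es v with end e ≟ v
  ... | yes _ = refl
  ... | no  _ = refl

  walk-balance : ∀ {u w es} → Walk G u w es → ∀ v → entering v es + δ u v ≡ leaving v es + δ w v
  walk-balance nil v = refl
  walk-balance {w = w} {e ∷ es} (cons refl p) v = begin
    entering v (e ∷ es) + a    ≡⟨ cong (_+ a) (length-filter-∷ (hd G) e es v) ⟩
    b + entering v es + a      ≡⟨ +-comm (b + entering v es) a ⟩
    a + (b + entering v es)    ≡⟨ cong (a +_) (+-comm b (entering v es)) ⟩
    a + (entering v es + b)    ≡⟨ cong (a +_) (walk-balance p v) ⟩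
    a + (leaving v es + δ w v) ≡⟨ +-assoc a (leaving v es) (δ w v) ⟨
    a + leaving v es + δ w v   ≡⟨ cong (_+ δ w v) (length-filter-∷ (tl G) e es v) ⟨
    leaving v (e ∷ es) + δ w v ∎
    where
    open ≡-Reasoning
    a = δ (tl G e) v
    b = δ (hd G e) v

  flowOf : List (List (Edge G)) → Edge G → ℕ
  flowOf ps e = ∑ ps (occ e)

  flowOf-pos : ∀ {ps e} → 0 < flowOf ps e → ∃ λ p → p ∈ ps × e ∈ p
  flowOf-pos {ps} {e} pos with ∑-pos ps (occ e) pos
  ... | p , p∈ , occ>0 = p , p∈ , occ-pos⁻ p occ>0

  flowOf-positive : ∀ {f ps} → (∀ e → f e ≡ flowOf ps e) → All (All (InSupp G f)) ps
  flowOf-positive {f} {ps} f≡ = All.tabulate (λ p∈ → All.tabulate (λ {x} x∈ →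
    ≤-trans (occ-pos x∈) (≤-trans (term≤∑ (occ x) p∈) (≤-reflexive (sym (f≡ x))))))

  count-pos : ∀ {e p ps} → p ∈ ps → e ∈ p → 0 < count G e ps
  count-pos {e} p∈ e∈ = filter-some (λ q → Any.any? (e ≟_) q) (lose p∈ e∈)

  count-zero : ∀ {e} ps → (∀ {p} → p ∈ ps → ¬ e ∈ p) → count G e ps ≡ 0
  count-zero {e} ps e∉ = cong length (filter-none (λ q → Any.any? (e ≟_) q) (All.tabulate e∉))

  count≤flowOf : ∀ e ps → count G e ps ≤ flowOf ps e
  count≤flowOf e []       = z≤n
  count≤flowOf e (q ∷ ps) with Any.any? (e ≟_) q
  ... | yes e∈ = +-mono-≤ (occ-pos e∈) (count≤flowOf e ps)
  ... | no  _  = ≤-trans (count≤flowOf e ps) (m≤n+m _ (occ e q))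

  module _ (s t : Vertex G) where

    flow-+ : ∀ {f g} → IsFlow G s t f → IsFlow G s t g → IsFlow G s t (λ e → f e + g e)
    flow-+ {f} {g} F H v v≢s v≢t = begin
      inflow G (λ e → f e + g e) v  ≡⟨ ∑-+ (edgesInto v) f g ⟩
      inflow G f v + inflow G g v   ≡⟨ cong₂ _+_ (F v v≢s v≢t) (H v v≢s v≢t) ⟩
      outflow G f v + outflow G g v ≡⟨ ∑-+ (edgesOutOf v) f g ⟨
      outflow G (λ e → f e + g e) v ∎
      where open ≡-Reasoning

    flow-∸ : ∀ {f g} → IsFlow G s t f → IsFlow G s t g → (∀ e → g e ≤ f e) →
             IsFlow G s t (λ e → f e ∸ g e)
    flow-∸ {f} {g} F H g≤f v v≢s v≢t = +-cancelʳ-≡ (inflow G g v) _ _ (begin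
      inflow G f∸g v + inflow G g v         ≡⟨ ∑-+ (edgesInto v) f∸g g ⟨
      inflow G (λ e → f∸g e + g e) v        ≡⟨ ∑-cong (edgesInto v) (λ e → m∸n+n≡m (g≤f e)) ⟩
      inflow G f v                          ≡⟨ F v v≢s v≢t ⟩
      outflow G f v                         ≡⟨ ∑-cong (edgesOutOf v) (λ e → m∸n+n≡m (g≤f e)) ⟨
      outflow G (λ e → f∸g e + g e) v       ≡⟨ ∑-+ (edgesOutOf v) f∸g g ⟩
      outflow G f∸g v + outflow G g v       ≡⟨ cong (outflow G f∸g v +_) (H v v≢s v≢t) ⟨
      outflow G f∸g v + inflow G g v        ∎)
      where
      open ≡-Reasoning
      f∸g = λ e → f e ∸ g e

    flow-* : ∀ k {f} → IsFlow G s t f → IsFlow G s t (λ e → k * f e)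
    flow-* k {f} F v v≢s v≢t = begin
      inflow G (λ e → k * f e) v   ≡⟨ *-distribˡ-∑ (edgesInto v) k f ⟩
      k * inflow G f v             ≡⟨ cong (k *_) (F v v≢s v≢t) ⟩
      k * outflow G f v            ≡⟨ *-distribˡ-∑ (edgesOutOf v) k f ⟨
      outflow G (λ e → k * f e) v  ∎
      where open ≡-Reasoning

    walk-flow : ∀ {es} → Walk G s t es → IsFlow G s t (λ e → occ e es)
    walk-flow {es} p v v≢s v≢t = begin
      inflow G (λ e → occ e es) v   ≡⟨ ∑-occ-filter (λ e → hd G e ≟ v) es ⟩
      entering v es                 ≡⟨ +-identityʳ _ ⟨
      entering v es + 0             ≡⟨ cong (entering v es +_) (δ-≢ (λ s≡v → v≢s (sym s≡v))) ⟨
      entering v es + δ s v         ≡⟨ walk-balance p v ⟩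
      leaving v es + δ t v          ≡⟨ cong (leaving v es +_) (δ-≢ (λ t≡v → v≢t (sym t≡v))) ⟩
      leaving v es + 0              ≡⟨ +-identityʳ _ ⟩
      leaving v es                  ≡⟨ ∑-occ-filter (λ e → tl G e ≟ v) es ⟨
      outflow G (λ e → occ e es) v  ∎
      where open ≡-Reasoning

    flowOf-flow : ∀ {ps} → All (Walk G s t) ps → IsFlow G s t (flowOf ps)
    flowOf-flow []       v _ _ =
      trans (∑-zero (edgesInto v) (λ _ → refl)) (sym (∑-zero (edgesOutOf v) (λ _ → refl)))
    flowOf-flow (p ∷ ps) = flow-+ (walk-flow p) (flowOf-flow ps)

module _ (G : Multigraph) (short : ∀ {u w es} → Walk G u w es → length es < n G)
         {s t : Vertex G} (s-source : IsSource G s) {f : Edge G → ℕ} (F : IsFlow G s t f) where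

  flow-continues : ∀ {e} → 0 < f e → hd G e ≡ t ⊎ 0 < outflow G f (hd G e)
  flow-continues {e} fe>0 with hd G e ≟ t
  ... | yes hd≡t = inj₁ hd≡t
  ... | no  hd≢t = inj₂ (≤-trans fe>0 (≤-trans (flow≤inflow G f e)
                                                (≤-reflexive (F (hd G e) (s-source e) hd≢t))))

  search-to-sink : ∀ L {v} → v ≡ t ⊎ 0 < outflow G f v →
    (∃ λ es → Walk G v t es × All (InSupp G f) es) ⊎
    (∃ λ w → ∃ λ es → Walk G v w es × L ≤ length es)
  search-to-sink zero    _           = inj₂ (_ , [] , nil , z≤n)
  search-to-sink (suc L) (inj₁ refl) = inj₁ ([] , nil , [])
  search-to-sink (suc L) {v} (inj₂ pos) with ∑-pos (edgesOutOf G v) f pos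
  ... | e , e∈ , fe>0
      with search-to-sink L (flow-continues fe>0)
         | proj₂ (∈-filter⁻ (λ x → tl G x ≟ v) {xs = allFin (m G)} e∈)
  ...   | inj₁ (es , p , pos-es)   | tl≡v = inj₁ (e ∷ es , cons tl≡v p , fe>0 ∷ pos-es)
  ...   | inj₂ (w , es , p , long) | tl≡v = inj₂ (w , e ∷ es , cons tl≡v p , s≤s long)

  positive-walk-to-sink : ∀ {e} → 0 < f e → ∃ λ es → Walk G (hd G e) t es × All (InSupp G f) es
  positive-walk-to-sink fe>0 with search-to-sink (n G) (flow-continues fe>0)
  ... | inj₁ walk                = walk
  ... | inj₂ (_ , _ , p , long) = ⊥-elim (<⇒≱ (short p) long)

total : (G : Multigraph) → (Edge G → ℕ) → ℕ
total G g = ∑ (allFin (m G)) g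

total-residual< : ∀ G → Acyclic G → ∀ {u w p e} {g : Edge G → ℕ} →
                  Walk G u w p → All (InSupp G g) p → e ∈ p → total G (λ x → g x ∸ occ x p) < total G g
total-residual< G acyclic {p = p} {e} {g} W pos e∈ =
  ∑-mono-< (allFin (m G)) (λ {x} _ → m∸n≤m (g x) (occ x p)) (∈-allFin e)
           (∸-monoʳ-< (occ-pos e∈) (occ≤positive G acyclic W pos e))

module _ (G : Multigraph) (acyclic : Acyclic G) {s t : Vertex G}
         (s-source : IsSource G s) (t-sink : IsSink G t) where

  positive-walk-through : ∀ {f} → IsFlow G s t f → ∀ {e} → 0 < f e →
                          ∃ λ es → Walk G s t es × All (InSupp G f) es × e ∈ es
  -- The part before e is found by the same search in the reversed graph, whose sink is s.
  positive-walk-through F {e} fe>0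
    with positive-walk-to-sink (reversed G) (reversed-walk-length< G acyclic) t-sink
                               (flow-reversed G F) fe>0
       | positive-walk-to-sink G (walk-length< G acyclic) s-source F fe>0
  ... | before , p , pos-before | after , q , pos-after =
    reverse before ++ e ∷ after ,
    walk-++ G (walk-reversed G p) (cons refl q) ,
    ++⁺ (all-reverse G pos-before) (fe>0 ∷ pos-after) ,
    ∈-++⁺ʳ (reverse before) (here refl)

  flow-decomposition : ∀ {f} → IsFlow G s t f →
                       ∃ λ Rs → All (Walk G s t) Rs × (∀ e → f e ≡ flowOf G Rs e)
  flow-decomposition {f} F = decompose (suc (total G f)) F ≤-refl
    where
    decompose : ∀ T {g} → IsFlow G s t g → total G g < T →
                ∃ λ Rs → All (Walk G s t) Rs × (∀ e → g e ≡ flowOf G Rs e)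
    decompose (suc T) {g} H lt with any? (λ e → 0 <? g e)
    ... | no  none = [] , [] , λ e → n≤0⇒n≡0 (≮⇒≥ (λ ge>0 → none (e , ge>0)))
    ... | yes (e , ge>0) with positive-walk-through H ge>0
    ...   | R , W , pos , e∈
          with decompose T (flow-∸ G s t H (walk-flow G s t W) (occ≤positive G acyclic W pos))
                           (<-≤-trans (total-residual< G acyclic W pos e∈) (≤-pred lt))
    ...     | Rs , Ws , residual≡ = R ∷ Rs , W ∷ Ws , λ x →
      trans (sym (m+[n∸m]≡n (occ≤positive G acyclic W pos x))) (cong (occ x R +_) (residual≡ x))

-- The flow-subgraph

module _ (G : Multigraph) {f g : Edge G → ℕ} where

  inSubVertex-mono : InSupp G f ⊆ InSupp G g → ∀ {v} → InSubVertex G f v → InSubVertex G g v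
  inSubVertex-mono f⊆g {v} f-active (in≡0 , out≡0) =
    f-active (∑≡0-mono (edgesInto G v) f⊆g in≡0 , ∑≡0-mono (edgesOutOf G v) f⊆g out≡0)

  subPath-cong : InSupp G f ≐ InSupp G g → ∀ {p} → SubPath G f p → SubPath G g p
  subPath-cong (f⊆g , g⊆f) (u , w , W , (u-active , no-in) , (w-active , no-out) , pos) =
    u , w , W ,
    (inSubVertex-mono f⊆g u-active , λ e ge>0 → no-in e (g⊆f ge>0)) ,
    (inSubVertex-mono f⊆g w-active , λ e ge>0 → no-out e (g⊆f ge>0)) ,
    All.map f⊆g pos

  widthCover-cong : InSupp G f ≐ InSupp G g → ∀ {j} → WidthCover G f j → WidthCover G g j
  widthCover-cong f≐g (ps , len , paths , cover) =
    ps , len , All.map (subPath-cong f≐g) paths , λ e ge>0 → cover e (proj₂ f≐g ge>0)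

module _ (G : Multigraph) {s t : Vertex G} where

  fwidthCover-mono : ∀ {f g k} → (∀ e → g e ≤ f e) → InSupp G f ⊆ InSupp G g →
                     FWidthCover G s t g k → FWidthCover G s t f k
  fwidthCover-mono g≤f f⊆g (ps , len , walks , cover , count≤g) =
    ps , len , walks , (λ e fe>0 → cover e (f⊆g fe>0)) , λ e → ≤-trans (count≤g e) (g≤f e)

  flowOf-fwidthCover : ∀ {ps} → All (Walk G s t) ps → FWidthCover G s t (flowOf G ps) (length ps)
  flowOf-fwidthCover {ps} walks = ps , refl , walks , cover , λ e → count≤flowOf G e ps
    where
    cover : ∀ e → 0 < flowOf G ps e → Any (e ∈_) ps
    cover e pos with flowOf-pos G pos
    ... | p , p∈ , e∈ = lose p∈ e∈

module _ (G : Multigraph) {s t : Vertex G} (t-sink : IsSink G t)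
         {f : Edge G → ℕ} (F : IsFlow G s t f) where

  subSource≡source : ∀ {u} → SubSource G f u → u ≡ s
  subSource≡source {u} (u-active , no-in) with u ≟ s | u ≟ t
  ... | yes u≡s | _        = u≡s
  ... | no  u≢s | yes refl =
    ⊥-elim (u-active (inflow≡0 G no-in , inflow≡0 (reversed G) (λ e _ → t-sink e)))
  ... | no  u≢s | no  u≢t  =
    ⊥-elim (u-active (inflow≡0 G no-in , trans (sym (F u u≢s u≢t)) (inflow≡0 G no-in)))

module _ (G : Multigraph) {s t : Vertex G} (s-source : IsSource G s) (t-sink : IsSink G t)
         {f : Edge G → ℕ} (F : IsFlow G s t f) where

  subSink≡sink : ∀ {w} → SubSink G f w → w ≡ t
  subSink≡sink (w-active , no-out) =
    subSource≡source (reversed G) s-source (flow-reversed G F)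
                     ((λ in∧out → w-active (swap in∧out)) , no-out)

  subPath-walk : ∀ {p} → SubPath G f p → Walk G s t p
  subPath-walk {p} (u , w , W , u-source , w-sink , _) =
    subst₂ (λ a b → Walk G a b p) (subSource≡source G t-sink F u-source) (subSink≡sink w-sink) W

  positive-walk-subPath : ∀ {p} → Walk G s t p → 0 < length p → All (InSupp G f) p → SubPath G f p
  positive-walk-subPath {e ∷ es} W@(cons tl≡s _) _ pos@(fe>0 ∷ _) =
    s , t , W , (s-active , λ x _ → s-source x) , (t-active , λ x _ → t-sink x) , pos
    where
    s-active : InSubVertex G f s
    s-active (_ , out≡0) =
      <⇒≢ (≤-trans fe>0 (subst (λ v → f e ≤ outflow G f v) tl≡s (flow≤outflow G f e))) (sym out≡0)
    t-active : InSubVertex G f t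
    t-active (in≡0 , _) with walk-end-edge G W
    ... | x , x∈ , hd≡t =
      <⇒≢ (≤-trans (All.lookup pos x∈) (subst (λ v → f x ≤ inflow G f v) hd≡t (flow≤inflow G f x)))
          (sym in≡0)

  fwidthCover⇒widthCover : ∀ {k} → FWidthCover G s t f k → ∃ λ j → j ≤ k × WidthCover G f j
  fwidthCover⇒widthCover (ps , refl , walks , cover , count≤f) =
    length qs , length-filter nonempty? ps , qs , refl , All.tabulate subPath , cover′
    where
    nonempty? : Decidable (λ (p : List (Edge G)) → 0 < length p)
    nonempty? p = 0 <? length p
    qs = filter nonempty? ps
    positive : ∀ {p} → p ∈ ps → All (InSupp G f) p
    positive p∈ = All.tabulate (λ {e} e∈ → ≤-trans (count-pos G p∈ e∈) (count≤f e))
    subPath : ∀ {q} → q ∈ qs → SubPath G f q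
    subPath q∈ with ∈-filter⁻ nonempty? {xs = ps} q∈
    ... | q∈ps , nonempty = positive-walk-subPath (All.lookup walks q∈ps) nonempty (positive q∈ps)
    cover′ : ∀ e → InSupp G f e → Any (e ∈_) qs
    cover′ e fe>0 with find (cover e fe>0)
    ... | p , p∈ , e∈ = lose (∈-filter⁺ nonempty? p∈ (∈⇒length-pos e∈)) e∈

  widthCover⇒scaled-fwidthCover : ∀ {a k} → a ≤ k → WidthCover G f a →
                                  FWidthCover G s t (λ e → k * f e) a
  widthCover⇒scaled-fwidthCover {a} {k} a≤k (ps , refl , subPaths , cover) =
    ps , refl , All.map subPath-walk subPaths , (λ e pos → cover e (*-pos⁻ʳ k pos)) , count≤
    where
    off-support : ∀ {e} → f e ≡ 0 → ∀ {p} → p ∈ ps → ¬ e ∈ p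
    off-support fe≡0 p∈ e∈ with All.lookup subPaths p∈
    ... | _ , _ , _ , _ , _ , pos = <-irrefl (sym fe≡0) (All.lookup pos e∈)
    count≤ : ∀ e → count G e ps ≤ k * f e
    count≤ e with f e in fe
    ... | suc _ = ≤-trans (length-filter _ ps) (≤-trans a≤k (m≤m*n k (suc _)))
    ... | zero  = ≤-reflexive (trans (count-zero G ps (off-support fe)) (sym (*-zeroʳ k)))

least : {P : ℕ → Set} → (∀ j → Dec (P j)) → ∀ {k} → P k → Σ ℕ (IsMin P)
least {P} P? {k} pk = [ (λ min → min) , (λ none → ⊥-elim (none k ≤-refl pk)) ] (search (suc k))
  where
  search : ∀ i → Σ ℕ (IsMin P) ⊎ (∀ j → j < i → ¬ P j)
  search zero = inj₂ (λ _ ())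
  search (suc i) with search i
  ... | inj₁ min  = inj₁ min
  ... | inj₂ none with P? i
  ...   | yes pi  = inj₁ (i , pi , λ j pj → ≮⇒≥ (λ j<i → none j j<i pj))
  ...   | no  ¬pi = inj₂ (λ j j<1+i →
    [ (λ j<i → none j j<i) , (λ { refl → ¬pi }) ] (m<1+n⇒m<n∨m≡n j<1+i))

IsMin-unique : ∀ {P a b} → IsMin P a → IsMin P b → a ≡ b
IsMin-unique (pa , a-min) (pb , b-min) = ≤-antisym (a-min _ pb) (b-min _ pa)

∃-list≤? : ∀ {k} L {P : List (Fin k) → Set} → Decidable P →
           Dec (∃ λ xs → length xs ≤ L × P xs)
∃-list≤? zero P? with P? []
... | yes p  = yes ([] , z≤n , p)
... | no  ¬p = no λ { ([] , _ , p) → ¬p p }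
∃-list≤? (suc L) P? with P? [] | any? (λ x → ∃-list≤? L (λ xs → P? (x ∷ xs)))
... | yes p  | _                       = yes ([] , z≤n , p)
... | no  _  | yes (x , xs , len≤ , p) = yes (x ∷ xs , s≤s len≤ , p)
... | no  ¬p | no  ¬q                  =
  no λ { ([] , _ , p) → ¬p p ; (x ∷ xs , s≤s len≤ , p) → ¬q (x , xs , len≤ , p) }

∃-list≡? : {A : Set} {B : A → Set} →
           (∀ {P : A → Set} → Decidable P → Dec (∃ λ x → B x × P x)) →
           ∀ j {P : List A → Set} → Decidable P → Dec (∃ λ xs → length xs ≡ j × All B xs × P xs)
∃-list≡? search zero P? with P? []
... | yes p  = yes ([] , refl , [] , p)
... | no  ¬p = no λ { ([] , _ , _ , p) → ¬p p }
∃-list≡? search (suc j) P? with search (λ x → ∃-list≡? search j (λ xs → P? (x ∷ xs)))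
... | yes (x , bx , xs , len , bxs , p) = yes (x ∷ xs , cong suc len , bx ∷ bxs , p)
... | no  ¬q =
  no λ { (x ∷ xs , len , bx ∷ bxs , p) → ¬q (x , bx , xs , suc-injective len , bxs , p) }

module _ (G : Multigraph) where

  walk? : ∀ u w es → Dec (Walk G u w es)
  walk? u w [] with u ≟ w
  ... | yes refl = yes nil
  ... | no  u≢w  = no λ { nil → u≢w refl }
  walk? u w (e ∷ es) with tl G e ≟ u | walk? (hd G e) w es
  ... | yes tl≡u | yes p  = yes (cons tl≡u p)
  ... | no  tl≢u | _      = no λ { (cons tl≡u _) → tl≢u tl≡u }
  ... | _        | no  ¬p = no λ { (cons _ p) → ¬p p }

  module _ (f : Edge G → ℕ) where

    inSubVertex? : Decidable (InSubVertex G f)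
    inSubVertex? v = ¬? ((inflow G f v Data.Nat.≟ 0) ×-dec (outflow G f v Data.Nat.≟ 0))

    subSource? : Decidable (SubSource G f)
    subSource? v = inSubVertex? v ×-dec all? (λ e → (0 <? f e) →-dec ¬? (hd G e ≟ v))

    subSink? : Decidable (SubSink G f)
    subSink? v = inSubVertex? v ×-dec all? (λ e → (0 <? f e) →-dec ¬? (tl G e ≟ v))

    subPath? : Decidable (SubPath G f)
    subPath? p = any? (λ u → any? (λ w →
      walk? u w p ×-dec subSource? u ×-dec subSink? w ×-dec All.all? (λ e → 0 <? f e) p))

    covers? : ∀ ps → Dec (∀ e → InSupp G f e → Any (e ∈_) ps)
    covers? ps = all? (λ e → (0 <? f e) →-dec Any.any? (λ p → Any.any? (e ≟_) p) ps)

    module _ (acyclic : Acyclic G) where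

      widthCover? : ∀ j → Dec (WidthCover G f j)
      widthCover? j with ∃-list≡? (∃-list≤? (n G)) j (λ ps → All.all? subPath? ps ×-dec covers? ps)
      ... | yes (ps , len , _ , paths , cover) = yes (ps , len , paths , cover)
      ... | no  ¬cover = no λ (ps , len , paths , cover) →
        ¬cover (ps , len , All.map (λ (_ , _ , W , _) → <⇒≤ (walk-length< G acyclic W)) paths ,
                paths , cover)

      width-exists : ∀ {k} → WidthCover G f k → Σ ℕ (Width G f)
      width-exists = least widthCover?

-- Leaving a vertex set

module Cut (G : Multigraph) {In : Vertex G → Set} (In? : Decidable In) where

  Exit : Edge G → Set
  Exit x = In (tl G x) × ¬ In (hd G x)

  Outside : Edge G → Set
  Outside x = ¬ In (tl G x) × ¬ In (hd G x)

  NoReentry : Edge G → Set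
  NoReentry x = ¬ In (tl G x) → ¬ In (hd G x)

  exit? : Decidable Exit
  exit? x = In? (tl G x) ×-dec ¬? (In? (hd G x))

  exits : List (Edge G) → ℕ
  exits xs = length (filter exit? xs)

  exitEdges : List (Edge G)
  exitEdges = filter exit? (allFin (m G))

  exits-++ : ∀ xs ys → exits (xs ++ ys) ≡ exits xs + exits ys
  exits-++ xs ys = trans (cong length (filter-++ exit? xs ys)) (length-++ (filter exit? xs))

  exits≡0 : ∀ {u w q} → Walk G u w q → All NoReentry q → ¬ In u → exits q ≡ 0
  exits≡0 nil _ _ = refl
  exits≡0 (cons refl p) (no-re ∷ no-res) ¬in-u =
    trans (cong length (filter-reject exit? (λ (in-tl , _) → ¬in-u in-tl))) (exits≡0 p no-res (no-re ¬in-u))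

  exits≤1 : ∀ {u w q} → Walk G u w q → All NoReentry q → exits q ≤ 1
  exits≤1 nil _ = z≤n
  exits≤1 {q = x ∷ q} (cons refl p) (_ ∷ no-res) with exit? x
  ... | yes exit@(_ , ¬in-hd) =
    ≤-reflexive (trans (cong length (filter-accept exit? exit)) (cong suc (exits≡0 p no-res ¬in-hd)))
  ... | no  ¬exit = subst (_≤ 1) (sym (cong length (filter-reject exit? ¬exit))) (exits≤1 p no-res)

  last-exit : ∀ {u w es} → Walk G u w es → ¬ In w →
    (¬ In u × All Outside es) ⊎
    (∃ λ X → ∃ λ e → ∃ λ Z → es ≡ X ++ e ∷ Z × Exit e × Walk G (hd G e) w Z × All Outside Z)
  last-exit nil ¬in-w = inj₁ (¬in-w , [])
  last-exit {u} (cons {e = e} {es} tl≡u p) ¬in-w with last-exit p ¬in-w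
  ... | inj₂ (X , x , Z , refl , exit , q , outside) = inj₂ (e ∷ X , x , Z , refl , exit , q , outside)
  ... | inj₁ (¬in-hd , outside) with In? u
  ...   | yes in-u  = inj₂ ([] , e , es , refl , (subst In (sym tl≡u) in-u , ¬in-hd) , p , outside)
  ...   | no  ¬in-u = inj₁ (¬in-u , ((λ in-tl → ¬in-u (subst In tl≡u in-tl)) , ¬in-hd) ∷ outside)

  ∑-exits : ∀ ps → ∑ ps exits ≡ ∑ exitEdges (flowOf G ps)
  ∑-exits ps = trans (sym (∑-cong ps (∑-occ-filter exit?))) (sym (∑-swap exitEdges ps (λ p x → occ x p)))

  exitFlow≤widthCover : ∀ {g : Edge G → ℕ} → (∀ {x} → InSupp G g x → NoReentry x) →
                        (∀ {x} → Exit x → g x ≤ 1) → ∀ {a} → WidthCover G g a → ∑ exitEdges g ≤ a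
  exitFlow≤widthCover {g} no-reentry exit≤1 (ps , refl , subPaths , cover) = begin
    ∑ exitEdges g                    ≤⟨ ∑-mono-≤ exitEdges g≤count ⟩
    ∑ exitEdges (λ x → count G x ps) ≤⟨ ∑-mono-≤ exitEdges (λ {x} _ → count≤flowOf G x ps) ⟩
    ∑ exitEdges (flowOf G ps)        ≡⟨ ∑-exits ps ⟨
    ∑ ps exits                       ≤⟨ ∑-mono-≤ ps exits-path≤1 ⟩
    ∑ ps (λ _ → 1)                   ≡⟨ ∑-const-1 ps ⟩
    length ps                        ∎
    where
    open ≤-Reasoning
    g≤count : ∀ {x} → x ∈ exitEdges → g x ≤ count G x ps
    g≤count {x} x∈ with g x in gx
    ... | zero  = z≤n
    ... | suc _ with find (cover x (subst (0 <_) (sym gx) z<s))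
    ...   | p , p∈ , x∈p =
      ≤-trans (subst (_≤ 1) gx (exit≤1 (proj₂ (∈-filter⁻ exit? {xs = allFin (m G)} x∈))))
              (count-pos G p∈ x∈p)
    exits-path≤1 : ∀ {p} → p ∈ ps → exits p ≤ 1
    exits-path≤1 p∈ with All.lookup subPaths p∈
    ... | _ , _ , W , _ , _ , pos = exits≤1 W (All.map no-reentry pos)

-- Heavy reachability

module _ (G : Multigraph) (acyclic : Acyclic G) (s : Vertex G) (f : Edge G → ℕ) where

  Heavy : Edge G → Set
  Heavy x = 2 ≤ f x

  HeavyReachable : Vertex G → Set
  HeavyReachable v = ∃ λ es → Walk G s v es × All Heavy es

  heavyReachable? : Decidable HeavyReachable
  heavyReachable? v with ∃-list≤? (n G) (λ es → walk? G s v es ×-dec All.all? (λ e → 2 ≤? f e) es)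
  ... | yes (es , _ , W , heavy) = yes (es , W , heavy)
  ... | no  ¬reach = no λ (es , W , heavy) → ¬reach (es , <⇒≤ (walk-length< G acyclic W) , W , heavy)

  open Cut G heavyReachable?

  heavy-step : ∀ {x} → HeavyReachable (tl G x) → Heavy x → HeavyReachable (hd G x)
  heavy-step {x} (es , W , heavy) hx = es ++ x ∷ [] , walk-++ G W (cons refl nil) , ++⁺ heavy (hx ∷ [])

  heavy-walk-reachable : ∀ {u v es} → Walk G u v es → HeavyReachable u → All Heavy es →
                         All (λ x → HeavyReachable (tl G x) × HeavyReachable (hd G x)) es
  heavy-walk-reachable nil           _ []           = []
  heavy-walk-reachable (cons refl p) r (hx ∷ heavy) =
    (r , heavy-step r hx) ∷ heavy-walk-reachable p (heavy-step r hx) heavy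

  exit-light : ∀ {x} → Exit x → f x ≤ 1
  exit-light (in-tl , ¬in-hd) = ≮⇒≥ (λ heavy → ¬in-hd (heavy-step in-tl heavy))

  residual-support : ∀ {u w P} → Walk G u w P → All Heavy P →
                     InSupp G f ≐ InSupp G (λ x → f x ∸ occ x P)
  residual-support {P = P} W heavy = f⊆residual , λ {x} pos → ≤-trans pos (m∸n≤m (f x) (occ x P))
    where
    f⊆residual : InSupp G f ⊆ InSupp G (λ x → f x ∸ occ x P)
    f⊆residual {x} fx>0 with Any.any? (x ≟_) P
    ... | yes x∈ = ∸-mono (All.lookup heavy x∈) (walk-occ≤1 G acyclic W x)
    ... | no  x∉ = subst (λ o → 0 < f x ∸ o) (sym (occ-∉ P x∉)) fx>0

  module _ {t : Vertex G} (t-unreachable : ¬ HeavyReachable t) where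

    Piece : List (Edge G) → List (Edge G) → Set
    Piece R P = Walk G s t P × All (λ x → InSupp G f x × NoReentry x) P × exits P ≡ 1
              × (∀ {x} → Exit x → occ x P ≤ occ x R)

    -- A heavy walk from s to the tail of the last exit edge of R, followed by the rest of R.
    piece : ∀ {R} → Walk G s t R → All (InSupp G f) R → ∃ (Piece R)
    piece W pos with last-exit W t-unreachable
    ... | inj₁ (¬in-s , _) = ⊥-elim (¬in-s ([] , nil , []))
    ... | inj₂ (X , e , Z , refl , (in-tl@(A , WA , heavyA) , ¬in-hd) , WZ , outsideZ) =
      A ++ e ∷ Z , walk-++ G WA (cons refl WZ) , ++⁺ A-ok (e-ok ∷ Z-ok) , exits-one , occ≤
      where
      A-reachable = heavy-walk-reachable WA ([] , nil , []) heavyA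
      R-pos : ∀ {x} → x ∈ e ∷ Z → InSupp G f x
      R-pos x∈ = All.lookup pos (∈-++⁺ʳ X x∈)
      A-ok = All.tabulate (λ x∈ →
        ≤-trans (n≤1+n 1) (All.lookup heavyA x∈) ,
        λ ¬in-tl → ⊥-elim (¬in-tl (proj₁ (All.lookup A-reachable x∈))))
      e-ok = R-pos (here refl) , λ ¬in-tl → ⊥-elim (¬in-tl in-tl)
      Z-ok = All.tabulate (λ x∈ → R-pos (there x∈) , λ _ → proj₂ (All.lookup outsideZ x∈))
      exits-one : exits (A ++ e ∷ Z) ≡ 1
      exits-one = begin
        exits (A ++ e ∷ Z)      ≡⟨ exits-++ A (e ∷ Z) ⟩
        exits A + exits (e ∷ Z) ≡⟨ cong₂ _+_ A-none (cong length (filter-accept exit? (in-tl , ¬in-hd))) ⟩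
        suc (exits Z)           ≡⟨ cong suc Z-none ⟩
        1                       ∎
        where
        open ≡-Reasoning
        A-none = cong length (filter-none exit?
          (All.map (λ (_ , in-hd) (_ , ¬in-hd) → ¬in-hd in-hd) A-reachable))
        Z-none = cong length (filter-none exit?
          (All.map (λ (¬in-tl , _) (in-tl , _) → ¬in-tl in-tl) outsideZ))
      occ≤ : ∀ {x} → Exit x → occ x (A ++ e ∷ Z) ≤ occ x (X ++ e ∷ Z)
      occ≤ {x} (_ , ¬in-hd) = begin
        occ x (A ++ e ∷ Z)      ≡⟨ ∑-++ A (e ∷ Z) (δ x) ⟩
        occ x A + occ x (e ∷ Z) ≡⟨ cong (_+ occ x (e ∷ Z)) (occ-∉ A x∉A) ⟩
        occ x (e ∷ Z)           ≤⟨ m≤n+m _ (occ x X) ⟩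
        occ x X + occ x (e ∷ Z) ≡⟨ ∑-++ X (e ∷ Z) (δ x) ⟨
        occ x (X ++ e ∷ Z)      ∎
        where
        open ≤-Reasoning
        x∉A = λ x∈ → ¬in-hd (proj₂ (All.lookup A-reachable x∈))

    pieces : ∀ {Rs} → All (Walk G s t) Rs → All (All (InSupp G f)) Rs →
      ∃ λ Ps → All (Walk G s t) Ps × All (All (λ x → InSupp G f x × NoReentry x)) Ps
             × ∑ Ps exits ≡ length Rs × (∀ {x} → Exit x → flowOf G Ps x ≤ flowOf G Rs x)
    pieces []       []           = [] , [] , [] , refl , λ _ → z≤n
    pieces (W ∷ Ws) (pos ∷ poss) with piece W pos | pieces Ws poss
    ... | P , WP , okP , exitsP , occP | Ps , WPs , okPs , exitsPs , occPs =
      P ∷ Ps , WP ∷ WPs , okP ∷ okPs , cong₂ _+_ exitsP exitsPs ,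
      λ exit → +-mono-≤ (occP exit) (occPs exit)

-- Width-stable graphs

module _ (G : Multigraph) (acyclic : Acyclic G) {s t : Vertex G}
         (s-source : IsSource G s) (t-sink : IsSink G t) (stable : WidthStable G s t) where

  decomposition≤widthCover : ∀ {f} → IsFlow G s t f → ¬ HeavyReachable G acyclic s f t →
    ∀ {Rs} → All (Walk G s t) Rs → (∀ e → f e ≡ flowOf G Rs e) → ∀ {j} → WidthCover G f j → length Rs ≤ j
  decomposition≤widthCover {f} F t-unreachable {Rs} walks f≡ {j} cover
    with pieces G acyclic s f t-unreachable walks (flowOf-positive G f≡)
  ... | Ps , walksPs , okPs , exitsPs , flowPs≤ = begin
    length Rs           ≡⟨ exitsPs ⟨
    ∑ Ps exits          ≡⟨ ∑-exits Ps ⟩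
    ∑ exitEdges f₁      ≤⟨ exitFlow≤widthCover (λ pos → proj₂ (f₁-ok pos)) f₁-exit≤1 (proj₁ Wa) ⟩
    a                   ≤⟨ stable f₁ f₂ F₁ F₂ (λ e → m≤m+n (f₁ e) (f e)) a b Wa Wb ⟩
    b                   ≤⟨ proj₂ Wb j (widthCover-cong G f≐f₂ cover) ⟩
    j                   ∎
    where
    open ≤-Reasoning
    open Cut G (heavyReachable? G acyclic s f)
    -- Heavy prefixes may be shared by many pieces, so f₁ ≤ f can fail; f₂ has the support of f.
    f₁ f₂ : Edge G → ℕ
    f₁ = flowOf G Ps
    f₂ x = f₁ x + f x
    F₁ = flowOf-flow G s t walksPs
    F₂ = flow-+ G s t F₁ F
    f₁-ok : ∀ {x} → 0 < f₁ x → InSupp G f x × NoReentry x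
    f₁-ok pos with flowOf-pos G pos
    ... | p , p∈ , x∈ = All.lookup (All.lookup okPs p∈) x∈
    f₁-exit≤1 : ∀ {x} → Exit x → f₁ x ≤ 1
    f₁-exit≤1 {x} exit =
      ≤-trans (flowPs≤ exit) (≤-trans (≤-reflexive (sym (f≡ x))) (exit-light G acyclic s f exit))
    f≐f₂ : InSupp G f ≐ InSupp G f₂
    f≐f₂ = (λ {x} fx>0 → ≤-trans fx>0 (m≤n+m (f x) (f₁ x))) ,
           (λ {x} f₂x>0 → [ (λ f₁x>0 → proj₁ (f₁-ok f₁x>0)) , (λ fx>0 → fx>0) ]
                            (+-pos⁻ (f₁ x) f₂x>0))
    W₁ = width-exists G f₁ acyclic
           (proj₂ (proj₂ (fwidthCover⇒widthCover G s-source t-sink F₁ (flowOf-fwidthCover G walksPs))))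
    W₂ = width-exists G f₂ acyclic (widthCover-cong G f≐f₂ cover)
    a = proj₁ W₁
    Wa = proj₂ W₁
    b = proj₁ W₂
    Wb = proj₂ W₂

  ShortFWidthCover : (Edge G → ℕ) → Set
  ShortFWidthCover f = ∃ λ k → FWidthCover G s t f k × (∀ j → WidthCover G f j → k ≤ j)

  short-fwidthCover-unreachable : ∀ {f} → IsFlow G s t f → ¬ HeavyReachable G acyclic s f t →
                                  ShortFWidthCover f
  short-fwidthCover-unreachable F t-unreachable with flow-decomposition G acyclic s-source t-sink F
  ... | Rs , walks , f≡ =
    length Rs ,
    fwidthCover-mono G (λ e → ≤-reflexive (sym (f≡ e))) (λ {e} fe>0 → subst (0 <_) (f≡ e) fe>0)
                     (flowOf-fwidthCover G walks) ,
    λ j → decomposition≤widthCover F t-unreachable walks f≡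

  short-fwidthCover-residual : ∀ {f P} → Walk G s t P → All (Heavy G acyclic s f) P →
    ShortFWidthCover (λ x → f x ∸ occ x P) → ShortFWidthCover f
  short-fwidthCover-residual {f} {P} W heavy (k , C , below) =
    k , fwidthCover-mono G (λ x → m∸n≤m (f x) (occ x P)) (proj₁ f≐residual) C ,
    λ j cover → below j (widthCover-cong G f≐residual cover)
    where f≐residual = residual-support G acyclic s f W heavy

  short-fwidthCover-s≡t : ∀ {f} → IsFlow G s t f → s ≡ t → ShortFWidthCover f
  short-fwidthCover-s≡t {f} F s≡t = 0 , ([] , refl , [] , no-flow , λ _ → z≤n) , λ _ _ → z≤n
    where
    no-flow : ∀ e → InSupp G f e → Any (e ∈_) []
    no-flow e fe>0 with positive-walk-through G acyclic s-source t-sink F fe>0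
    ... | x ∷ xs , W , _ = ⊥-elim (acyclic s x xs (subst (λ v → Walk G s v (x ∷ xs)) (sym s≡t) W))

  short-fwidthCover : ∀ {f} → IsFlow G s t f → ShortFWidthCover f
  short-fwidthCover {f} F = go (suc (total G f)) F ≤-refl
    where
    go : ∀ T {g} → IsFlow G s t g → total G g < T → ShortFWidthCover g
    go (suc T) {g} H lt with heavyReachable? G acyclic s g t
    ... | no  t-unreachable       = short-fwidthCover-unreachable H t-unreachable
    ... | yes ([] , W , _)        = short-fwidthCover-s≡t H (walk-[] G W)
    ... | yes (e ∷ P , W , heavy) = short-fwidthCover-residual W heavy (go T
      (flow-∸ G s t H (walk-flow G s t W) (occ≤positive G acyclic W positive))
      (<-≤-trans (total-residual< G acyclic W positive (here refl)) (≤-pred lt)))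
      where positive = All.map (≤-trans (n≤1+n 1)) heavy

  fwidth≡width : ∀ {f} → IsFlow G s t f → Σ ℕ (λ k → FWidth G s t f k × Width G f k)
  fwidth≡width {f} F with short-fwidthCover F
  ... | k , C , below with fwidthCover⇒widthCover G s-source t-sink F C
  ...   | j , j≤k , cover =
    k , (C , k-min) , subst (WidthCover G f) (≤-antisym j≤k (below j cover)) cover , below
    where
    k-min : ∀ k′ → FWidthCover G s t f k′ → k ≤ k′
    k-min k′ C′ with fwidthCover⇒widthCover G s-source t-sink F C′
    ... | j′ , j′≤k′ , cover′ = ≤-trans (below j′ cover′) j′≤k′

scaled-fwidth : ∀ G {s t : Vertex G} → IsSource G s → IsSink G t → ∀ {f a k} → IsFlow G s t f →
                Width G f a → a ≤ suc k → FWidth G s t (λ e → suc k * f e) a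
scaled-fwidth G s-source t-sink {f} {a} {k} F (cover , a-min) a≤ =
  widthCover⇒scaled-fwidthCover G s-source t-sink F a≤ cover , scaled-min
  where
  scaled≐f : InSupp G (λ e → suc k * f e) ≐ InSupp G f
  scaled≐f = *-pos⁻ʳ (suc k) , λ {x} fx>0 → ≤-trans fx>0 (m≤m+n (f x) (k * f x))
  scaled-min : ∀ j → FWidthCover G _ _ (λ e → suc k * f e) j → a ≤ j
  scaled-min j C with fwidthCover⇒widthCover G s-source t-sink (flow-* G _ _ (suc k) F) C
  ... | j′ , j′≤j , cover′ = ≤-trans (a-min j′ (widthCover-cong G scaled≐f cover′)) j′≤j

FWidthMonotone : (G : Multigraph) → Vertex G → Vertex G → Set
FWidthMonotone G s t = ∀ (f h : Edge G → ℕ) → IsFlow G s t f → IsFlow G s t h → f ≤ᶠ h →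
  ∀ a b → FWidth G s t f a → FWidth G s t h b → a ≤ b

module _ (G : Multigraph) (acyclic : Acyclic G) {s t : Vertex G}
         (s-source : IsSource G s) (t-sink : IsSink G t) where

  widthStable⇒fwidthMonotone : WidthStable G s t → FWidthMonotone G s t
  widthStable⇒fwidthMonotone stable f h F H f≤h a b FWa FWb
    with fwidth≡width G acyclic s-source t-sink stable F | fwidth≡width G acyclic s-source t-sink stable H
  ... | k₁ , FW₁ , W₁ | k₂ , FW₂ , W₂ =
    subst₂ _≤_ (IsMin-unique FW₁ FWa) (IsMin-unique FW₂ FWb) (stable f h F H f≤h k₁ k₂ W₁ W₂)

  fwidthMonotone⇒widthStable : FWidthMonotone G s t → WidthStable G s t
  fwidthMonotone⇒widthStable monotone f g F Gf f≤g a b Wa Wb =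
    monotone (λ e → K * f e) (λ e → K * g e) (flow-* G s t K F) (flow-* G s t K Gf)
             (λ e → *-monoʳ-≤ K (f≤g e)) a b
             (scaled-fwidth G s-source t-sink F Wa (m≤n⇒m≤1+n (m≤m+n a b)))
             (scaled-fwidth G s-source t-sink Gf Wb (m≤n⇒m≤1+n (m≤n+m b a)))
    where K = suc (a + b)

lemma16 : (G : Multigraph) (s t : Vertex G) → Acyclic G → SingleSource G s → SingleSink G t →
    (WidthStable G s t → ∀ (f : Edge G → ℕ) → IsFlow G s t f →
        Σ ℕ (λ k → FWidth G s t f k × Width G f k))
    × (WidthStable G s t ⇔
        (∀ (f h : Edge G → ℕ) → IsFlow G s t f → IsFlow G s t h → f ≤ᶠ h →
           ∀ a b → FWidth G s t f a → FWidth G s t h b → a ≤ b))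
lemma16 G s t acyclic (s-source , _) (t-sink , _) =
  (λ stable f → fwidth≡width G acyclic s-source t-sink stable) ,
  mk⇔ (widthStable⇒fwidthMonotone G acyclic s-source t-sink)
      (fwidthMonotone⇒widthStable G acyclic s-source t-sink)
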